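{- Let $C$ be an $X$-neighbour transitive code in $H(m,q)$ with minimum distance $\delta$, and let $\ell\geq 1$. Then $\mathrm{Prod}_\ell(C)$ is $(X\wr S_\ell)$-neighbour transitive in $H(m\ell,q)$ with minimum distance $\delta$.
   Context: $H(m,q)$ is the Hamming graph on $Q^m$ ($|Q|=q$), vertices adjacent iff they differ in one entry; $\mathrm{Aut}(H(m,q))=S_q^m\rtimes S_m$. For a code $C$, its neighbour set $C_1$ is the set of vertices at distance exactly $1$ from $C$; $C$ is $X$-neighbour transitive if $C$ and $C_1$ are $X$-orbits. The set of $\ell$-tuples $(\alpha_1,\ldots,\alpha_\ell)$ of vertices of $H(m,q)$ is identified with the vertex set of $H(m\ell,q)$ (by concatenation). $\mathrm{Prod}_\ell(C)=\{(\alpha_1,\ldots,\alpha_\ell):\alpha_i\in C\}$. The group $X\wr S_\ell$ acts by $(\alpha_1,\ldots,\alpha_\ell)^{(x_1,\ldots,x_\ell)\sigma}=(\alpha_{1\sigma^{ -1}}^{x_{1\sigma^{ -1}}},\ldots,\alpha_{\ell\sigma^{ -1}}^{x_{\ell\sigma^{ -1}}})$, giving a subgroup of $\mathrm{Aut}(H(m\ell,q))$. -}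

module Defs where

open import Data.Nat using (ℕ; zero; suc; _+_; _*_; _≤_)
open import Data.Fin using (Fin)
import Data.Fin as Fin
open import Data.Vec using (Vec; []; _∷_; concat; lookup; tabulate)
open import Data.Vec.Relation.Unary.All using (All)
open import Data.Fin.Permutation using (Permutation′; _⟨$⟩ˡ_)
open import Data.Product using (Σ; ∃; _×_; _,_)
open import Data.Bool using (if_then_else_)
open import Relation.Nullary using (¬_; does)
open import Relation.Binary.PropositionalEquality using (_≡_)
open import Function using (_∘_; id; _⇔_)
open import Function.Definitions using (Injective; Surjective)

Vtx : ℕ → ℕ → Set
Vtx m q = Vec (Fin q) m

dist : ∀ {m q} → Vtx m q → Vtx m q → ℕ
dist []       []       = 0
dist (a ∷ α) (b ∷ β) = (if does (a Fin.≟ b) then 0 else 1) + dist α β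

Adj : ∀ {m q} → Vtx m q → Vtx m q → Set
Adj α β = dist α β ≡ 1

Code : ℕ → ℕ → Set₁
Code m q = Vtx m q → Set

HasMinDist : ∀ {m q} → Code m q → ℕ → Set
HasMinDist C δ =
  (∃ λ α → ∃ λ β → C α × C β × ¬ (α ≡ β) × dist α β ≡ δ)
  × (∀ α β → C α → C β → ¬ (α ≡ β) → δ ≤ dist α β)

Nbr : ∀ {m q} → Code m q → Code m q
Nbr C ν = ¬ C ν × ∃ λ α → C α × dist α ν ≡ 1

IsAut : ∀ {m q} → (Vtx m q → Vtx m q) → Set
IsAut {m} {q} f =
  Injective _≡_ _≡_ f × Surjective _≡_ _≡_ f
  × (∀ α β → Adj α β ⇔ Adj (f α) (f β))

AutGroup : ℕ → ℕ → Set₁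
AutGroup m q = (Vtx m q → Vtx m q) → Set

IsSubgroupAut : ∀ {m q} → AutGroup m q → Set
IsSubgroupAut X =
  (∀ f → X f → IsAut f)
  × X id
  × (∀ f g → X f → X g → X (g ∘ f))
  × (∀ f → X f → ∃ λ g → X g × (∀ α → g (f α) ≡ α))

IsOrbit : ∀ {m q} → AutGroup m q → Code m q → Set
IsOrbit X S = ∃ λ α → S α × (∀ β → S β ⇔ (∃ λ x → X x × x α ≡ β))

IsNeighbourTransitive : ∀ {m q} → AutGroup m q → Code m q → Set
IsNeighbourTransitive X C = IsOrbit X C × IsOrbit X (Nbr C)

Prod : ∀ {m q} (ℓ : ℕ) → Code m q → Code (ℓ * m) q
Prod {m} {q} ℓ C β = ∃ λ (αs : Vec (Vtx m q) ℓ) → All C αs × concat αs ≡ β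

-- X ≀ S_ℓ acting on H(ℓ·m, q):
-- (α₁,…,α_ℓ)^{(x₁,…,x_ℓ)σ} = (α_{1σ⁻¹}^{x_{1σ⁻¹}}, …, α_{ℓσ⁻¹}^{x_{ℓσ⁻¹}}).
Wr : ∀ {m q} → AutGroup m q → (ℓ : ℕ) → AutGroup (ℓ * m) q
Wr {m} {q} X ℓ g =
  ∃ λ (x : Fin ℓ → Vtx m q → Vtx m q) → (∀ i → X (x i))
  × ∃ λ (σ : Permutation′ ℓ) →
      ∀ (αs : Vec (Vtx m q) ℓ) →
        g (concat αs) ≡ concat (tabulate λ i → x (σ ⟨$⟩ˡ i) (lookup αs (σ ⟨$⟩ˡ i)))

-- A vertex of H(ℓm,q) is a tuple of ℓ blocks, and it is adjacent to another tuple exactly when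
-- the two agree in all blocks but one, where they are adjacent in H(m,q). Hence Prod_ℓ(C) is the
-- set of tuples with every block in C, and its neighbours are the tuples with exactly one block in
-- C₁ and all others in C. Both sets have the shape "block p lies in S(σ⁻¹ p) for some permutation σ"
-- with each S k an X-orbit, and any such set is a single X ≀ S_ℓ-orbit: the base group moves each
-- block within its orbit and the top group permutes the blocks. Minimum distance: distances add
-- over blocks, and two distinct tuples differ in some block.
module Submission where

open import Defs
open import Data.Nat using (ℕ; zero; suc; _+_; _*_; _≤_)
open import Data.Nat.Properties using (suc-injective; m≤m+n; m≤n+m; ≤-trans; +-identityʳ)
open import Data.Product using (_×_; ∃; _,_; proj₁; proj₂)
open import Data.Fin using (Fin; zero; suc; _≟_)
import Data.Fin.Properties as Fin
open import Data.Fin.Permutation using (Permutation′; _⟨$⟩ˡ_; _⟨$⟩ʳ_; inverseˡ; inverseʳ; transpose)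
import Data.Fin.Permutation as Permutation
open import Data.Vec using (Vec; []; _∷_; _++_; concat; lookup; tabulate; group; _[_]≔_)
open import Data.Vec.Properties
  using (++-injectiveˡ; ++-injectiveʳ; lookup∘tabulate; tabulate∘lookup; tabulate-cong; ≡-dec; lookup∘update; lookup∘update′)
open import Data.Vec.Relation.Unary.All using (All; _∷_)
open import Data.Vec.Relation.Unary.All.Properties using (lookup⁺; lookup⁻)
open import Relation.Nullary using (¬_; yes; no; contradiction)
open import Relation.Binary.PropositionalEquality using (_≡_; _≢_; refl; sym; trans; cong; cong₂; subst)
open import Function using (_∘_; _⇔_; mk⇔; Equivalence)

private
  variable
    A : Set
    k m n q δ : ℕ
    C : Code m q
    X : AutGroup m q

concat-injective : (as bs : Vec (Vec A k) n) → concat as ≡ concat bs → as ≡ bs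
concat-injective []       []       _  = refl
concat-injective (a ∷ as) (b ∷ bs) eq =
  cong₂ _∷_ (++-injectiveˡ a b eq) (concat-injective as bs (++-injectiveʳ a b eq))

lookup-extensionality : (as bs : Vec A n) → (∀ i → lookup as i ≡ lookup bs i) → as ≡ bs
lookup-extensionality as bs eq =
  trans (sym (tabulate∘lookup as)) (trans (tabulate-cong eq) (tabulate∘lookup bs))

dist-refl : (α : Vtx m q) → dist α α ≡ 0
dist-refl []      = refl
dist-refl (a ∷ α) with a ≟ a
... | yes _  = dist-refl α
... | no a≢a = contradiction refl a≢a

dist≡0⇒≡ : (α β : Vtx m q) → dist α β ≡ 0 → α ≡ β
dist≡0⇒≡ []      []      _ = refl
dist≡0⇒≡ (a ∷ α) (b ∷ β) d with a ≟ b
... | yes a≡b = cong₂ _∷_ a≡b (dist≡0⇒≡ α β d)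

dist-++ : (α β : Vtx m q) (γ η : Vtx k q) → dist (α ++ γ) (β ++ η) ≡ dist α β + dist γ η
dist-++ []      []      γ η = refl
dist-++ (a ∷ α) (b ∷ β) γ η with a ≟ b
... | yes _ = dist-++ α β γ η
... | no _  = cong suc (dist-++ α β γ η)

AdjacentAt : Fin n → Vec (Vtx m q) n → Vec (Vtx m q) n → Set
AdjacentAt i αs βs = Adj (lookup αs i) (lookup βs i) × (∀ j → j ≢ i → lookup αs j ≡ lookup βs j)

Adj-concat⇒AdjacentAt : (αs βs : Vec (Vtx m q) n) → Adj (concat αs) (concat βs) → ∃ λ i → AdjacentAt i αs βs
Adj-concat⇒AdjacentAt []       []       ()
Adj-concat⇒AdjacentAt (α ∷ αs) (β ∷ βs) adj
  with dist α β in head | trans (sym (dist-++ α β (concat αs) (concat βs))) adj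
... | 0 | tail-adj =
  let i , adjᵢ , eqⱼ = Adj-concat⇒AdjacentAt αs βs tail-adj in
  suc i , adjᵢ , λ { zero _ → dist≡0⇒≡ α β head ; (suc j) j≢i → eqⱼ j (j≢i ∘ cong suc) }
... | 1 | tail-equal =
  zero , head , λ { zero 0≢0 → contradiction refl 0≢0
                  ; (suc j) _ → cong (λ γs → lookup γs j) αs≡βs }
  where
  αs≡βs : αs ≡ βs
  αs≡βs = concat-injective αs βs (dist≡0⇒≡ (concat αs) (concat βs) (suc-injective tail-equal))
... | suc (suc _) | ()

AdjacentAt⇒Adj-concat : (αs βs : Vec (Vtx m q) n) (i : Fin n) → AdjacentAt i αs βs → Adj (concat αs) (concat βs)
AdjacentAt⇒Adj-concat (α ∷ αs) (β ∷ βs) zero (adj , eqⱼ)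
  rewrite dist-++ α β (concat αs) (concat βs) | adj
        | lookup-extensionality αs βs (λ j → eqⱼ (suc j) λ ())
        | dist-refl (concat βs) = refl
AdjacentAt⇒Adj-concat (α ∷ αs) (β ∷ βs) (suc i) (adj , eqⱼ)
  rewrite dist-++ α β (concat αs) (concat βs) | eqⱼ zero (λ ()) | dist-refl β =
  AdjacentAt⇒Adj-concat αs βs i (adj , λ j j≢i → eqⱼ (suc j) (j≢i ∘ Fin.suc-injective))

concat-dist-lower-bound : (∀ α β → C α → C β → α ≢ β → δ ≤ dist α β)
  → (αs βs : Vec (Vtx m q) n) → All C αs → All C βs → αs ≢ βs → δ ≤ dist (concat αs) (concat βs)
concat-dist-lower-bound bound [] [] _ _ []≢[] = contradiction refl []≢[]
concat-dist-lower-bound {C = C} bound (α ∷ αs) (β ∷ βs) (cα ∷ cαs) (cβ ∷ cβs) αs≢βs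
  rewrite dist-++ α β (concat αs) (concat βs) with ≡-dec _≟_ α β
... | yes refl = ≤-trans (concat-dist-lower-bound {C = C} bound αs βs cαs cβs (αs≢βs ∘ cong (α ∷_))) (m≤n+m _ _)
... | no α≢β   = ≤-trans (bound α β cα cβ α≢β) (m≤m+n _ _)

Prod-concat⁻ : (γs : Vec (Vtx m q) n) → Prod n C (concat γs) → All C γs
Prod-concat⁻ {C = C} γs (αs , cαs , eq) = subst (All C) (concat-injective αs γs eq) cαs

-- Pad a pair of codewords at distance δ with copies of one of them.
Prod-HasMinDist : HasMinDist C δ → HasMinDist (Prod (suc n) C) δ
Prod-HasMinDist {C = C} {δ = δ} {n = n} ((α , β , cα , cβ , α≢β , dαβ) , bound) =
  ( concat (α ∷ pad) , concat (β ∷ pad)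
  , (α ∷ pad , cα ∷ cpad , refl) , (β ∷ pad , cβ ∷ cpad , refl)
  , α≢β ∘ ++-injectiveˡ α β
  , trans (dist-++ α β (concat pad) (concat pad)) (trans (cong₂ _+_ dαβ (dist-refl (concat pad))) (+-identityʳ δ)) )
  , λ { _ _ (αs , cαs , refl) (βs , cβs , refl) ≢ →
        concat-dist-lower-bound {C = C} bound αs βs cαs cβs (≢ ∘ cong concat) }
  where
  pad : Vec (Vtx _ _) n
  pad = tabulate (λ _ → α)
  cpad : All C pad
  cpad = lookup⁻ (λ i → subst C (sym (lookup∘tabulate (λ _ → α) i)) cα)

OneNbrBlockAt : Code m q → Fin n → Vec (Vtx m q) n → Set
OneNbrBlockAt C i γs = Nbr C (lookup γs i) × (∀ j → j ≢ i → C (lookup γs j))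

-- Replacing the C₁-block by an adjacent codeword gives an adjacent element of Prod n C.
Nbr-Prod-concat⁺ : (γs : Vec (Vtx m q) n) (i : Fin n) → OneNbrBlockAt C i γs → Nbr (Prod n C) (concat γs)
Nbr-Prod-concat⁺ {C = C} γs i ((γᵢ∉C , α , cα , adj) , cⱼ) =
  (λ p → γᵢ∉C (lookup⁺ (Prod-concat⁻ γs p) i))
  , concat αs , (αs , lookup⁻ cαs , refl) , AdjacentAt⇒Adj-concat αs γs i (adjᵢ , eqⱼ)
  where
  αs : Vec (Vtx _ _) _
  αs = γs [ i ]≔ α
  eqⱼ : ∀ j → j ≢ i → lookup αs j ≡ lookup γs j
  eqⱼ j j≢i = lookup∘update′ j≢i γs α
  adjᵢ : Adj (lookup αs i) (lookup γs i)
  adjᵢ = subst (λ β → Adj β (lookup γs i)) (sym (lookup∘update i γs α)) adj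
  cαs : ∀ j → C (lookup αs j)
  cαs j with j ≟ i
  ... | yes refl = subst C (sym (lookup∘update i γs α)) cα
  ... | no j≢i   = subst C (sym (eqⱼ j j≢i)) (cⱼ j j≢i)

Nbr-Prod-concat⁻ : (γs : Vec (Vtx m q) n) → Nbr (Prod n C) (concat γs) → ∃ λ i → OneNbrBlockAt C i γs
Nbr-Prod-concat⁻ {C = C} γs (∉Prod , _ , (αs , cαs , refl) , adj)
  with Adj-concat⇒AdjacentAt αs γs adj
... | i , adjᵢ , eqⱼ = i , (γᵢ∉C , lookup αs i , lookup⁺ cαs i , adjᵢ) , cⱼ
  where
  cⱼ : ∀ j → j ≢ i → C (lookup γs j)
  cⱼ j j≢i = subst C (eqⱼ j j≢i) (lookup⁺ cαs j)
  γᵢ∉C : ¬ C (lookup γs i)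
  γᵢ∉C cᵢ = ∉Prod (γs , lookup⁻ cγs , refl)
    where
    cγs : ∀ j → C (lookup γs j)
    cγs j with j ≟ i
    ... | yes refl = cᵢ
    ... | no j≢i   = cⱼ j j≢i

-- σ ⟨$⟩ˡ_ is the σ⁻¹ of the wreath action in Wr.
Pattern : (Fin n → Code m q) → Permutation′ n → Vec (Vtx m q) n → Set
Pattern S σ γs = ∀ p → S (σ ⟨$⟩ˡ p) (lookup γs p)

PatternCode : (Fin n → Code m q) → Code (n * m) q
PatternCode S v = ∃ λ σ → ∃ λ γs → Pattern S σ γs × concat γs ≡ v

splitBlocks : Vtx (n * m) q → Vec (Vtx m q) n
splitBlocks {n} {m} v = proj₁ (group n m v)

concat-splitBlocks : (v : Vtx (n * m) q) → concat (splitBlocks {n} v) ≡ v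
concat-splitBlocks {n} {m} v = sym (proj₂ (group n m v))

splitBlocks-concat : (γs : Vec (Vtx m q) n) → splitBlocks (concat γs) ≡ γs
splitBlocks-concat {n = n} γs = concat-injective _ γs (concat-splitBlocks {n} (concat γs))

wrAct : (Fin n → Vtx m q → Vtx m q) → Permutation′ n → Vec (Vtx m q) n → Vec (Vtx m q) n
wrAct x σ αs = tabulate λ p → x (σ ⟨$⟩ˡ p) (lookup αs (σ ⟨$⟩ˡ p))

wrAct∈Wr : (x : Fin n → Vtx m q → Vtx m q) → (∀ k → X (x k)) → (σ : Permutation′ n)
  → Wr X n (concat ∘ wrAct x σ ∘ splitBlocks)
wrAct∈Wr {X = X} x xX σ = x , xX , σ , λ αs → cong (concat ∘ wrAct x σ) (splitBlocks-concat αs)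

IsOrbit-cong : {S T : Code m q} → (∀ v → S v ⇔ T v) → IsOrbit X S → IsOrbit X T
IsOrbit-cong S⇔T (α , sα , orbit) =
  α , Equivalence.to (S⇔T α) sα , λ β → mk⇔ (Equivalence.to (orbit β) ∘ Equivalence.from (S⇔T β))
                                               (Equivalence.to (S⇔T β) ∘ Equivalence.from (orbit β))

IsOrbit-image : {S : Code m q} (o : IsOrbit X S) → ∀ x → X x → S (x (proj₁ o))
IsOrbit-image (α , _ , orbit) x xX = Equivalence.from (orbit (x α)) (x , xX , refl)

PatternCode-isOrbit : {S : Fin n → Code m q} → (∀ k → IsOrbit X (S k)) → IsOrbit (Wr X n) (PatternCode S)
PatternCode-isOrbit {n = n} {m = m} {q = q} {X = X} {S = S} o =
  concat (tabulate b) , (Permutation.id , tabulate b , base∈ , refl) , λ v → mk⇔ (reach v) (image v)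
  where
  b : Fin n → Vtx m q
  b k = proj₁ (o k)

  base∈ : Pattern S Permutation.id (tabulate b)
  base∈ p = subst (S p) (sym (lookup∘tabulate b p)) (proj₁ (proj₂ (o p)))

  reach : ∀ v → PatternCode S v → ∃ λ g → Wr X n g × g (concat (tabulate b)) ≡ v
  reach _ (σ , γs , blocks∈ , refl) =
    concat ∘ wrAct x σ ∘ splitBlocks , wrAct∈Wr {X = X} x xX σ ,
    cong concat (trans (cong (wrAct x σ) (splitBlocks-concat (tabulate b)))
                       (lookup-extensionality _ γs blockwise))
    where
    mover : ∀ p → ∃ λ y → X y × y (b (σ ⟨$⟩ˡ p)) ≡ lookup γs p
    mover p = Equivalence.to (proj₂ (proj₂ (o (σ ⟨$⟩ˡ p))) (lookup γs p)) (blocks∈ p)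
    x : Fin n → Vtx m q → Vtx m q
    x k = proj₁ (mover (σ ⟨$⟩ʳ k))
    xX : ∀ k → X (x k)
    xX k = proj₁ (proj₂ (mover (σ ⟨$⟩ʳ k)))
    -- x (σ⁻¹ p) is mover (σ (σ⁻¹ p)), which is mover p only up to inverseʳ σ.
    mover-moves : ∀ {p′} p → p′ ≡ p → proj₁ (mover p′) (b (σ ⟨$⟩ˡ p)) ≡ lookup γs p
    mover-moves p refl = proj₂ (proj₂ (mover p))
    blockwise : ∀ p → lookup (wrAct x σ (tabulate b)) p ≡ lookup γs p
    blockwise p
      rewrite lookup∘tabulate (λ p → x (σ ⟨$⟩ˡ p) (lookup (tabulate b) (σ ⟨$⟩ˡ p))) p
            | lookup∘tabulate b (σ ⟨$⟩ˡ p) = mover-moves p (inverseʳ σ)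

  image : ∀ v → (∃ λ g → Wr X n g × g (concat (tabulate b)) ≡ v) → PatternCode S v
  image _ (g , (x , xX , σ , acts) , refl) = σ , wrAct x σ (tabulate b) , blocks∈ , sym (acts (tabulate b))
    where
    blocks∈ : Pattern S σ (wrAct x σ (tabulate b))
    blocks∈ p
      rewrite lookup∘tabulate (λ p → x (σ ⟨$⟩ˡ p) (lookup (tabulate b) (σ ⟨$⟩ˡ p))) p
            | lookup∘tabulate b (σ ⟨$⟩ˡ p) = IsOrbit-image (o (σ ⟨$⟩ˡ p)) (x (σ ⟨$⟩ˡ p)) (xX _)

PatternCode-const⇔Prod : (v : Vtx (n * m) q) → PatternCode (λ _ → C) v ⇔ Prod n C v
PatternCode-const⇔Prod v =
  mk⇔ (λ (_ , γs , blocks∈ , eq) → γs , lookup⁻ blocks∈ , eq)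
      (λ (γs , cγs , eq) → Permutation.id , γs , lookup⁺ cγs , eq)

NbrPattern : Code m q → Fin (suc n) → Code m q
NbrPattern C zero    = Nbr C
NbrPattern C (suc _) = C

NbrPattern-≢zero : {α : Vtx m q} (k : Fin (suc n)) → k ≢ zero → NbrPattern C k α ⇔ C α
NbrPattern-≢zero zero    k≢0 = contradiction refl k≢0
NbrPattern-≢zero (suc _) _   = mk⇔ (λ c → c) (λ c → c)

Pattern-NbrPattern⇔ : (σ : Permutation′ (suc n)) (γs : Vec (Vtx m q) (suc n))
  → Pattern (NbrPattern C) σ γs ⇔ OneNbrBlockAt C (σ ⟨$⟩ʳ zero) γs
Pattern-NbrPattern⇔ {C = C} σ γs = mk⇔ to from
  where
  σˡ≢zero : ∀ p → p ≢ σ ⟨$⟩ʳ zero → σ ⟨$⟩ˡ p ≢ zero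
  σˡ≢zero p p≢ σˡp≡0 = p≢ (trans (sym (inverseʳ σ)) (cong (σ ⟨$⟩ʳ_) σˡp≡0))

  to : Pattern (NbrPattern C) σ γs → OneNbrBlockAt C (σ ⟨$⟩ʳ zero) γs
  to blocks∈ =
    subst (λ k → NbrPattern C k (lookup γs (σ ⟨$⟩ʳ zero))) (inverseˡ σ) (blocks∈ (σ ⟨$⟩ʳ zero)) ,
    λ j j≢ → Equivalence.to (NbrPattern-≢zero {C = C} _ (σˡ≢zero j j≢)) (blocks∈ j)

  from : OneNbrBlockAt C (σ ⟨$⟩ʳ zero) γs → Pattern (NbrPattern C) σ γs
  from (nbr , cⱼ) p with p ≟ σ ⟨$⟩ʳ zero
  ... | yes refl = subst (λ k → NbrPattern C k (lookup γs p)) (sym (inverseˡ σ)) nbr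
  ... | no p≢    = Equivalence.from (NbrPattern-≢zero {C = C} _ (σˡ≢zero p p≢)) (cⱼ p p≢)

PatternCode-NbrPattern⇔Nbr-Prod : (v : Vtx (suc n * m) q) → PatternCode (NbrPattern C) v ⇔ Nbr (Prod (suc n) C) v
PatternCode-NbrPattern⇔Nbr-Prod {n = n} {m = m} {C = C} v = mk⇔ from to
  where
  γs : Vec (Vtx m _) (suc n)
  γs = splitBlocks v

  concat-γs : concat γs ≡ v
  concat-γs = concat-splitBlocks {suc n} v

  to : Nbr (Prod (suc n) C) v → PatternCode (NbrPattern C) v
  to nbr with Nbr-Prod-concat⁻ γs (subst (Nbr (Prod (suc n) C)) (sym concat-γs) nbr)
  ... | i , oneNbr = transpose zero i , γs ,
                     Equivalence.from (Pattern-NbrPattern⇔ (transpose zero i) γs) oneNbr , concat-γs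

  from : PatternCode (NbrPattern C) v → Nbr (Prod (suc n) C) v
  from (σ , βs , blocks∈ , refl) =
    Nbr-Prod-concat⁺ βs (σ ⟨$⟩ʳ zero) (Equivalence.to (Pattern-NbrPattern⇔ σ βs) blocks∈)

lemma3p1 : (m q δ ℓ : ℕ) (X : AutGroup m q) (C : Code m q)
    → IsSubgroupAut X
    → IsNeighbourTransitive X C
    → HasMinDist C δ
    → 1 ≤ ℓ
    → IsNeighbourTransitive (Wr X ℓ) (Prod ℓ C) × HasMinDist (Prod ℓ C) δ
lemma3p1 m q δ zero    X C _ _ _ ()
lemma3p1 m q δ (suc n) X C _ (C-orbit , C₁-orbit) minDist _ =
  ( IsOrbit-cong PatternCode-const⇔Prod (PatternCode-isOrbit (λ _ → C-orbit))
  , IsOrbit-cong PatternCode-NbrPattern⇔Nbr-Prod (PatternCode-isOrbit blockOrbits) )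
  , Prod-HasMinDist minDist
  where
  blockOrbits : ∀ k → IsOrbit X (NbrPattern C k)
  blockOrbits zero    = C₁-orbit
  blockOrbits (suc _) = C-orbit
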